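{- There is an absolute constant $c>0$ such that for all (sufficiently large) $d$ and all integers $r\ge0$, $$s(r)\ge c\, b(r)^{1-1/d}.$$
   Context: For $x\in\mathbb{Z}^d$, $|x|$ denotes the $\ell_1$-norm. $B(r)=\{x\in\mathbb{Z}^d:|x|\le r\}$, $S(r)=\{x\in\mathbb{Z}^d:|x|=r\}$, $b(r)=|B(r)|$, $s(r)=|S(r)|$. -}

module Defs where

open import Data.Nat using (ℕ; zero; suc; _+_; _*_; _≟_; _≤?_)
open import Data.Integer as ℤ using (ℤ; +_; ∣_∣)
open import Data.List using (List; []; _∷_; [_]; map; concatMap; upTo; length; filter)
open import Data.Vec using (Vec; []; _∷_)

norm₁ : {d : ℕ} → Vec ℤ d → ℕ
norm₁ []       = 0
norm₁ (x ∷ xs) = ∣ x ∣ + norm₁ xs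

ints : ℕ → List ℤ
ints r = map (λ i → (+ i) ℤ.- (+ r)) (upTo (suc (r + r)))

vecs : (d : ℕ) → List ℤ → List (Vec ℤ d)
vecs zero    l = [ [] ]
vecs (suc d) l = concatMap (λ x → map (x ∷_) (vecs d l)) l

-- the box [-r, r]^d, which contains B(r) (without repetitions)
box : (d r : ℕ) → List (Vec ℤ d)
box d r = vecs d (ints r)

b : (d r : ℕ) → ℕ
b d r = length (filter (λ x → norm₁ x ≤? r) (box d r))

s : (d r : ℕ) → ℕ
s d r = length (filter (λ x → norm₁ x ≟ r) (box d r))

module Submission where

-- Splitting off one coordinate, the number of points of ℤ^(d+1) of norm ≤ m (or = m) is
-- X(m) + 2 Σ_{j<m} X(j), where X counts in ℤ^d.  From this recursion: b_d(m+1) = b_d(m) + s_d(m+1)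
-- and s_{d+1}(m) + s_d(m) = 2 b_d(m), so b_{d-1} ≤ s_d; a joint induction on d and m gives
-- (d-1) b_d(r) ≤ 2 (r+d-1) b_{d-1}(r), whence d b_d(r) ≤ 4 (d+r) s_d(r).  Conversely the ball
-- contains the cube [-k, k]^d for k = ⌊r/d⌋, so (d+r)^d ≤ (2d)^d b_d(r).  Together
-- (d+r)^d b^(d-1) ≤ (2d b)^d ≤ ((d+r) 8s)^d, i.e. the theorem with c = 1/8 for d ≥ 2.

open import Defs
open import Data.Nat using (ℕ; _*_; _^_; _∸_; _≤_; _<_)
open import Data.Product using (Σ-syntax; _×_)

open import Data.Nat
open import Data.Nat.Properties
open import Data.Nat.DivMod using (_/_; _%_; m≡m%n+[m/n]*n; m%n<n; m/n*n≤m)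
open import Data.Nat.ListAction using (sum)
open import Data.Nat.Tactic.RingSolver using (solve-∀)
import Data.Integer as ℤ
import Data.Integer.Properties as ℤ
open import Data.List using (List; []; _∷_; [_]; map; concatMap; upTo; applyUpTo; length; filter; _++_)
open import Data.List.Properties
  using (length-++; filter-++; filter-≐; filter-none; filter-accept; map-∘; map-upTo; map-cong)
import Data.List.Relation.Unary.All as All
open import Data.Vec using (Vec; []; _∷_)
open import Data.Product using (_,_; proj₁; proj₂)
open import Function using (_∘_; _⇔_; mk⇔; Equivalence)
open Equivalence using (to; from)
open import Relation.Nullary using (Dec; yes; no; ¬_)
open import Relation.Unary using (Pred; Decidable)
open import Relation.Binary.PropositionalEquality hiding ([_])

sumBelow : ℕ → (ℕ → ℕ) → ℕ
sumBelow zero    f = 0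
sumBelow (suc n) f = f 0 + sumBelow n (f ∘ suc)

syntax sumBelow n (λ i → e) = ∑[ i < n ] e

sumBelow-suc : ∀ n (f : ℕ → ℕ) → ∑[ i < suc n ] f i ≡ ∑[ i < n ] f i + f n
sumBelow-suc zero    f = +-comm (f 0) 0
sumBelow-suc (suc n) f = trans (cong (f 0 +_) (sumBelow-suc n (f ∘ suc))) (sym (+-assoc (f 0) _ _))

sumBelow-+ : ∀ m n (f : ℕ → ℕ) → ∑[ i < m + n ] f i ≡ ∑[ i < m ] f i + ∑[ j < n ] f (m + j)
sumBelow-+ zero    n f = refl
sumBelow-+ (suc m) n f = trans (cong (f 0 +_) (sumBelow-+ m n (f ∘ suc))) (sym (+-assoc (f 0) _ _))

sumBelow-cong : ∀ n {f g : ℕ → ℕ} → (∀ i → i < n → f i ≡ g i) → ∑[ i < n ] f i ≡ ∑[ i < n ] g i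
sumBelow-cong zero    f≡g = refl
sumBelow-cong (suc n) f≡g = cong₂ _+_ (f≡g 0 z<s) (sumBelow-cong n (λ i i<n → f≡g (suc i) (s<s i<n)))

sumBelow-zero : ∀ n {f : ℕ → ℕ} → (∀ i → f i ≡ 0) → ∑[ i < n ] f i ≡ 0
sumBelow-zero zero    f≡0 = refl
sumBelow-zero (suc n) f≡0 = cong₂ _+_ (f≡0 0) (sumBelow-zero n (f≡0 ∘ suc))

sumBelow-reverse : ∀ n (f : ℕ → ℕ) → ∑[ i < n ] f (n ∸ suc i) ≡ ∑[ i < n ] f i
sumBelow-reverse zero    f = refl
sumBelow-reverse (suc n) f = begin
  f n + ∑[ i < n ] f (n ∸ suc i) ≡⟨ cong (f n +_) (sumBelow-reverse n f) ⟩
  f n + ∑[ i < n ] f i           ≡⟨ +-comm (f n) _ ⟩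
  ∑[ i < n ] f i + f n           ≡⟨ sumBelow-suc n f ⟨
  ∑[ i < suc n ] f i             ∎
  where open ≡-Reasoning

sum-applyUpTo : ∀ n (f : ℕ → ℕ) → sum (applyUpTo f n) ≡ ∑[ i < n ] f i
sum-applyUpTo zero    f = refl
sum-applyUpTo (suc n) f = cong (f 0 +_) (sum-applyUpTo n (f ∘ suc))

-- Lattice points counted coordinate by coordinate

module _ {a p} {A : Set a} {P : Pred A p} (P? : Decidable P) where

  length-filter-++ : ∀ xs ys → length (filter P? (xs ++ ys)) ≡ length (filter P? xs) + length (filter P? ys)
  length-filter-++ xs ys = trans (cong length (filter-++ P? xs ys)) (length-++ (filter P? xs))

  length-filter-concatMap : ∀ {b} {B : Set b} (f : B → List A) xs →
    length (filter P? (concatMap f xs)) ≡ sum (map (λ x → length (filter P? (f x))) xs)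
  length-filter-concatMap f []       = refl
  length-filter-concatMap f (x ∷ xs) =
    trans (length-filter-++ (f x) (concatMap f xs))
          (cong (length (filter P? (f x)) +_) (length-filter-concatMap f xs))

  length-filter-map : ∀ {b} {B : Set b} (f : B → A) xs →
    length (filter P? (map f xs)) ≡ length (filter (P? ∘ f) xs)
  length-filter-map f []       = refl
  length-filter-map f (x ∷ xs) with P? (f x)
  ... | yes _ = cong suc (length-filter-map f xs)
  ... | no  _ = length-filter-map f xs

∣i-R∣≡1+[R∸1+i] : ∀ {i R} → i < R → ℤ.∣ ℤ.+ i ℤ.- ℤ.+ R ∣ ≡ suc (R ∸ suc i)
∣i-R∣≡1+[R∸1+i] {i} {R} i<R = begin
  ℤ.∣ ℤ.+ i ℤ.- ℤ.+ R ∣ ≡⟨ cong ℤ.∣_∣ (ℤ.m-n≡m⊖n i R) ⟩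
  ℤ.∣ i ℤ.⊖ R ∣         ≡⟨ ℤ.∣⊖∣-≤ (<⇒≤ i<R) ⟩
  R ∸ i                 ≡⟨ +-∸-assoc 1 i<R ⟩
  suc (R ∸ suc i)       ∎
  where open ≡-Reasoning

∣[R+j]-R∣≡j : ∀ R j → ℤ.∣ ℤ.+ (R + j) ℤ.- ℤ.+ R ∣ ≡ j
∣[R+j]-R∣≡j R j = begin
  ℤ.∣ ℤ.+ (R + j) ℤ.- ℤ.+ R ∣ ≡⟨ cong ℤ.∣_∣ (ℤ.m-n≡m⊖n (R + j) R) ⟩
  ℤ.∣ (R + j) ℤ.⊖ R ∣         ≡⟨ ℤ.∣m⊖n∣≡∣n⊖m∣ (R + j) R ⟩
  ℤ.∣ R ℤ.⊖ (R + j) ∣         ≡⟨ ℤ.∣⊖∣-≤ (m≤m+n R j) ⟩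
  R + j ∸ R                   ≡⟨ m+n∸m≡n R j ⟩
  j                           ∎
  where open ≡-Reasoning

sum-map-abs-ints : ∀ R (H : ℕ → ℕ) → sum (map (H ∘ ℤ.∣_∣) (ints R)) ≡ H 0 + 2 * ∑[ j < R ] H (suc j)
sum-map-abs-ints R H = begin
  sum (map (H ∘ ℤ.∣_∣) (map shift (upTo (suc (R + R)))))
    ≡⟨ cong sum (map-∘ (upTo (suc (R + R)))) ⟨
  sum (map (H ∘ ℤ.∣_∣ ∘ shift) (upTo (suc (R + R))))
    ≡⟨ cong sum (map-upTo _ (suc (R + R))) ⟩
  sum (applyUpTo (H ∘ ℤ.∣_∣ ∘ shift) (suc (R + R)))
    ≡⟨ sum-applyUpTo (suc (R + R)) (H ∘ ℤ.∣_∣ ∘ shift) ⟩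
  ∑[ i < suc (R + R) ] H ℤ.∣ shift i ∣
    ≡⟨ cong (λ n → ∑[ i < n ] H ℤ.∣ shift i ∣) (+-suc R R) ⟨
  ∑[ i < R + suc R ] H ℤ.∣ shift i ∣
    ≡⟨ sumBelow-+ R (suc R) _ ⟩
  ∑[ i < R ] H ℤ.∣ shift i ∣ + (H ℤ.∣ shift (R + 0) ∣ + ∑[ j < R ] H ℤ.∣ shift (R + suc j) ∣)
    ≡⟨ cong₂ _+_ left (cong₂ _+_ (cong H (∣[R+j]-R∣≡j R 0)) right) ⟩
  ∑[ j < R ] H (suc j) + (H 0 + ∑[ j < R ] H (suc j))
    ≡⟨ rearrange (H 0) (∑[ j < R ] H (suc j)) ⟩
  H 0 + 2 * ∑[ j < R ] H (suc j)
    ∎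
  where
  open ≡-Reasoning
  shift : ℕ → ℤ.ℤ
  shift i = ℤ.+ i ℤ.- ℤ.+ R
  left : ∑[ i < R ] H ℤ.∣ shift i ∣ ≡ ∑[ j < R ] H (suc j)
  left = trans (sumBelow-cong R (λ i i<R → cong H (∣i-R∣≡1+[R∸1+i] i<R))) (sumBelow-reverse R (H ∘ suc))
  right : ∑[ j < R ] H ℤ.∣ shift (R + suc j) ∣ ≡ ∑[ j < R ] H (suc j)
  right = sumBelow-cong R (λ j _ → cong H (∣[R+j]-R∣≡j R (suc j)))
  rearrange : ∀ x y → y + (x + y) ≡ x + 2 * y
  rearrange = solve-∀

addCoordinate : (ℕ → ℕ) → ℕ → ℕ
addCoordinate c m = c m + 2 * ∑[ j < m ] c j

profile : (ℕ → ℕ) → ℕ → ℕ → ℕ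
profile c₀ zero    = c₀
profile c₀ (suc d) = addCoordinate (profile c₀ d)

-- n ∼ m says that a point of norm n is counted at level m (n ≤ m for balls, n ≡ m for spheres).
-- A new coordinate x with ∣x∣ = a ≤ m lowers the level to m ∸ a, for one x if a = 0 and two if
-- a > 0; hence addCoordinate.  The box radius R ≥ m cuts off nothing.
module NormCount
  (_∼_ : ℕ → ℕ → Set) (_∼?_ : ∀ n m → Dec (n ∼ m))
  (∼-shift : ∀ a n m → (a + n) ∼ m ⇔ (a ≤ m × n ∼ (m ∸ a)))
  (c₀ : ℕ → ℕ) (count₀ : ∀ m → length (filter (λ (v : Vec ℤ.ℤ 0) → norm₁ v ∼? m) [ [] ]) ≡ c₀ m)
  where

  countNorm : ∀ d R m → m ≤ R → length (filter (λ v → norm₁ v ∼? m) (vecs d (ints R))) ≡ profile c₀ d m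
  countNorm zero    R m m≤R = count₀ m
  countNorm (suc d) R m m≤R = begin
    length (filter P? (concatMap (λ x → map (x ∷_) V) (ints R)))
      ≡⟨ length-filter-concatMap P? (λ x → map (x ∷_) V) (ints R) ⟩
    sum (map (λ x → length (filter P? (map (x ∷_) V))) (ints R))
      ≡⟨ cong sum (map-cong (λ x → length-filter-map P? (x ∷_) V) (ints R)) ⟩
    sum (map (H ∘ ℤ.∣_∣) (ints R))
      ≡⟨ sum-map-abs-ints R H ⟩
    H 0 + 2 * ∑[ a < R ] H (suc a)
      ≡⟨ cong₂ (λ u v → u + 2 * v) (countNorm d R m m≤R) sum-H ⟩
    addCoordinate (profile c₀ d) m
      ∎
    where
    open ≡-Reasoning
    V : List (Vec ℤ.ℤ d)
    V = vecs d (ints R)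
    P? : (v : Vec ℤ.ℤ (suc d)) → Dec (norm₁ v ∼ m)
    P? v = norm₁ v ∼? m
    H : ℕ → ℕ
    H a = length (filter (λ v → (a + norm₁ v) ∼? m) V)
    H-below : ∀ a → a < m → H (suc a) ≡ profile c₀ d (m ∸ suc a)
    H-below a a<m = begin
      H (suc a)
        ≡⟨ cong length (filter-≐ _ _ ((λ {v} → proj₂ ∘ to (shift v)) , λ {v} r → from (shift v) (a<m , r)) V) ⟩
      length (filter (λ v → norm₁ v ∼? (m ∸ suc a)) V)
        ≡⟨ countNorm d R (m ∸ suc a) (≤-trans (m∸n≤m m (suc a)) m≤R) ⟩
      profile c₀ d (m ∸ suc a)
        ∎
      where
      shift : ∀ v → (suc a + norm₁ v) ∼ m ⇔ (suc a ≤ m × norm₁ v ∼ (m ∸ suc a))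
      shift v = ∼-shift (suc a) (norm₁ v) m
    H-above : ∀ j → H (suc (m + j)) ≡ 0
    H-above j = cong length (filter-none _ (All.universal too-far V))
      where
      too-far : ∀ v → ¬ (suc (m + j) + norm₁ v) ∼ m
      too-far v r = <-irrefl refl (≤-trans (s≤s (m≤m+n m j)) (proj₁ (to (∼-shift _ _ m) r)))
    sum-H : ∑[ a < R ] H (suc a) ≡ ∑[ j < m ] profile c₀ d j
    sum-H = begin
      ∑[ a < R ] H (suc a)
        ≡⟨ cong (λ n → ∑[ a < n ] H (suc a)) (m+[n∸m]≡n m≤R) ⟨
      ∑[ a < m + (R ∸ m) ] H (suc a)
        ≡⟨ sumBelow-+ m (R ∸ m) (H ∘ suc) ⟩
      ∑[ a < m ] H (suc a) + ∑[ j < R ∸ m ] H (suc (m + j))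
        ≡⟨ cong₂ _+_ (sumBelow-cong m H-below) (sumBelow-zero (R ∸ m) H-above) ⟩
      ∑[ a < m ] profile c₀ d (m ∸ suc a) + 0
        ≡⟨ +-identityʳ _ ⟩
      ∑[ a < m ] profile c₀ d (m ∸ suc a)
        ≡⟨ sumBelow-reverse m (profile c₀ d) ⟩
      ∑[ j < m ] profile c₀ d j
        ∎

δ₀ : ℕ → ℕ
δ₀ zero    = 1
δ₀ (suc _) = 0

ballCount : ℕ → ℕ → ℕ
ballCount = profile (λ _ → 1)

sphereCount : ℕ → ℕ → ℕ
sphereCount = profile δ₀

+≤⇔≤∸ : ∀ a n m → a + n ≤ m ⇔ (a ≤ m × n ≤ m ∸ a)
+≤⇔≤∸ a n m = mk⇔
  (λ a+n≤m → ≤-trans (m≤m+n a n) a+n≤m , m+n≤o⇒m≤o∸n n (≤-trans (≤-reflexive (+-comm n a)) a+n≤m))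
  (λ (a≤m , n≤m∸a) → ≤-trans (≤-reflexive (+-comm a n)) (m≤o∸n⇒m+n≤o n a≤m n≤m∸a))

+≡⇔≡∸ : ∀ a n m → a + n ≡ m ⇔ (a ≤ m × n ≡ m ∸ a)
+≡⇔≡∸ a n m = mk⇔
  (λ a+n≡m → subst (a ≤_) a+n≡m (m≤m+n a n) , trans (sym (m+n∸m≡n a n)) (cong (_∸ a) a+n≡m))
  (λ (a≤m , n≡m∸a) → trans (cong (a +_) n≡m∸a) (m+[n∸m]≡n a≤m))

b≡ballCount : ∀ d r → b d r ≡ ballCount d r
b≡ballCount d r = NormCount.countNorm _≤_ _≤?_ +≤⇔≤∸ (λ _ → 1) count₀ d r r ≤-refl
  where
  count₀ : ∀ m → length (filter (λ (v : Vec ℤ.ℤ 0) → norm₁ v ≤? m) [ [] ]) ≡ 1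
  count₀ m = cong length (filter-accept (λ v → norm₁ v ≤? m) {[]} {[]} z≤n)

s≡sphereCount : ∀ d r → s d r ≡ sphereCount d r
s≡sphereCount d r = NormCount.countNorm _≡_ _≟_ +≡⇔≡∸ δ₀ count₀ d r r ≤-refl
  where
  count₀ : ∀ m → length (filter (λ (v : Vec ℤ.ℤ 0) → norm₁ v ≟ m) [ [] ]) ≡ δ₀ m
  count₀ zero    = refl
  count₀ (suc m) = refl

-- Recursions for ball and sphere sizes

addCoordinate-zero : ∀ c → addCoordinate c 0 ≡ c 0
addCoordinate-zero c = +-identityʳ (c 0)

addCoordinate-suc : ∀ c m → addCoordinate c (suc m) ≡ addCoordinate c m + c (suc m) + c m
addCoordinate-suc c m = begin
  c (suc m) + 2 * ∑[ j < suc m ] c j     ≡⟨ cong (λ t → c (suc m) + 2 * t) (sumBelow-suc m c) ⟩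
  c (suc m) + 2 * (∑[ j < m ] c j + c m) ≡⟨ rearrange (c (suc m)) (c m) (∑[ j < m ] c j) ⟩
  c m + 2 * ∑[ j < m ] c j + c (suc m) + c m ∎
  where
  open ≡-Reasoning
  rearrange : ∀ x y t → x + 2 * (t + y) ≡ y + 2 * t + x + y
  rearrange = solve-∀

ballCount-zero : ∀ d → ballCount d 0 ≡ 1
ballCount-zero zero    = refl
ballCount-zero (suc d) = trans (addCoordinate-zero (ballCount d)) (ballCount-zero d)

sphereCount-zero : ∀ d → sphereCount d 0 ≡ 1
sphereCount-zero zero    = refl
sphereCount-zero (suc d) = trans (addCoordinate-zero (sphereCount d)) (sphereCount-zero d)

mutual
  ballCount-suc : ∀ d m → ballCount d (suc m) ≡ ballCount d m + sphereCount d (suc m)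
  ballCount-suc zero    m = refl
  ballCount-suc (suc d) m = begin
    ballCount (suc d) (suc m)
      ≡⟨ addCoordinate-suc (ballCount d) m ⟩
    B′ m + ballCount d (suc m) + ballCount d m
      ≡⟨ cong (λ t → B′ m + t + ballCount d m) (ballCount-suc d m) ⟩
    B′ m + (ballCount d m + S (suc m)) + ballCount d m
      ≡⟨ collect (B′ m) (ballCount d m) (S (suc m)) ⟩
    B′ m + (2 * ballCount d m + S (suc m))
      ≡⟨ cong (λ t → B′ m + (t + S (suc m))) (sphereCount-suc-dim d m) ⟨
    B′ m + (S′ m + S m + S (suc m))
      ≡⟨ cong (B′ m +_) (swap (S′ m) (S m) (S (suc m))) ⟩
    B′ m + (S′ m + S (suc m) + S m)
      ≡⟨ cong (B′ m +_) (addCoordinate-suc (sphereCount d) m) ⟨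
    B′ m + S′ (suc m)
      ∎
    where
    open ≡-Reasoning
    B′ = ballCount (suc d)
    S  = sphereCount d
    S′ = sphereCount (suc d)
    collect : ∀ x y t → x + (y + t) + y ≡ x + (2 * y + t)
    collect = solve-∀
    swap : ∀ x y t → x + y + t ≡ x + t + y
    swap = solve-∀

  sphereCount-suc-dim : ∀ d m → sphereCount (suc d) m + sphereCount d m ≡ 2 * ballCount d m
  sphereCount-suc-dim d zero
    rewrite addCoordinate-zero (sphereCount d) | sphereCount-zero d | ballCount-zero d = refl
  sphereCount-suc-dim d (suc m) = begin
    S′ (suc m) + S (suc m)
      ≡⟨ cong (_+ S (suc m)) (addCoordinate-suc (sphereCount d) m) ⟩
    S′ m + S (suc m) + S m + S (suc m)
      ≡⟨ rearrange (S′ m) (S (suc m)) (S m) ⟩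
    (S′ m + S m) + 2 * S (suc m)
      ≡⟨ cong (_+ 2 * S (suc m)) (sphereCount-suc-dim d m) ⟩
    2 * ballCount d m + 2 * S (suc m)
      ≡⟨ *-distribˡ-+ 2 (ballCount d m) _ ⟨
    2 * (ballCount d m + S (suc m))
      ≡⟨ cong (2 *_) (ballCount-suc d m) ⟨
    2 * ballCount d (suc m)
      ∎
    where
    open ≡-Reasoning
    S  = sphereCount d
    S′ = sphereCount (suc d)
    rearrange : ∀ x y t → x + y + t + y ≡ (x + t) + 2 * y
    rearrange = solve-∀

ballCount≤sphereCount-suc : ∀ d m → ballCount d m ≤ sphereCount (suc d) m
ballCount≤sphereCount-suc d m = *-cancelˡ-≤ 2 (begin
  2 * ballCount d m                               ≡⟨ sphereCount-suc-dim d m ⟨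
  sphereCount (suc d) m + sphereCount d m         ≤⟨ +-monoʳ-≤ (sphereCount (suc d) m) (m≤m+n (sphereCount d m) _) ⟩
  sphereCount (suc d) m + sphereCount (suc d) m   ≡⟨ cong (sphereCount (suc d) m +_) (+-identityʳ _) ⟨
  2 * sphereCount (suc d) m                       ∎)
  where open ≤-Reasoning

-- Growth of ball sizes

ballCount-step : ∀ d m → ballCount d m ≤ ballCount d (suc m)
ballCount-step d m = ≤-trans (m≤m+n _ _) (≤-reflexive (sym (ballCount-suc d m)))

ballCount-mono : ∀ d k m → ballCount d m ≤ ballCount d (k + m)
ballCount-mono d zero    m = ≤-refl
ballCount-mono d (suc k) m = ≤-trans (ballCount-mono d k m) (ballCount-step d (k + m))

mutual
  ballCount-suc-radius≥ : ∀ d m → suc (m + d) * ballCount d m ≤ suc m * ballCount d (suc m)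
  ballCount-suc-radius≥ zero    m rewrite +-identityʳ m = ≤-refl
  ballCount-suc-radius≥ (suc d) m = begin
    suc (m + suc d) * B′ m
      ≡⟨ split m d (B′ m) ⟩
    suc m * B′ m + suc d * B′ m
      ≤⟨ +-monoʳ-≤ (suc m * B′ m) (ballCount-suc-dim≤-consecutive d m) ⟩
    suc m * B′ m + suc m * (B (suc m) + B m)
      ≡⟨ *-distribˡ-+ (suc m) (B′ m) _ ⟨
    suc m * (B′ m + (B (suc m) + B m))
      ≡⟨ cong (suc m *_) (+-assoc (B′ m) _ _) ⟨
    suc m * (B′ m + B (suc m) + B m)
      ≡⟨ cong (suc m *_) (addCoordinate-suc B m) ⟨
    suc m * B′ (suc m)
      ∎
    where
    open ≤-Reasoning
    B  = ballCount d
    B′ = ballCount (suc d)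
    split : ∀ m d x → suc (m + suc d) * x ≡ suc m * x + suc d * x
    split = solve-∀

  ballCount-suc-dim≤-consecutive : ∀ d m →
    suc d * ballCount (suc d) m ≤ suc m * (ballCount d (suc m) + ballCount d m)
  ballCount-suc-dim≤-consecutive d zero = begin
    suc d * ballCount (suc d) 0  ≡⟨ cong (suc d *_) (trans (ballCount-zero (suc d)) (sym (ballCount-zero d))) ⟩
    suc d * ballCount d 0        ≤⟨ ballCount-suc-radius≥ d 0 ⟩
    1 * ballCount d 1            ≤⟨ *-monoʳ-≤ 1 (m≤m+n (ballCount d 1) _) ⟩
    1 * (ballCount d 1 + ballCount d 0) ∎
    where open ≤-Reasoning
  ballCount-suc-dim≤-consecutive d (suc m) = begin
    suc d * B′ (suc m)
      ≡⟨ cong (suc d *_) (addCoordinate-suc B m) ⟩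
    suc d * (B′ m + B (suc m) + B m)
      ≡⟨ split d (B′ m) (B (suc m)) (B m) ⟩
    suc d * B′ m + suc d * (B (suc m) + B m)
      ≤⟨ +-monoˡ-≤ _ (ballCount-suc-dim≤-consecutive d m) ⟩
    suc m * (B (suc m) + B m) + suc d * (B (suc m) + B m)
      ≡⟨ regroup m d (B (suc m)) (B m) ⟩
    suc (suc m + d) * B (suc m) + (suc (m + d) * B m + B m)
      ≤⟨ +-mono-≤ (ballCount-suc-radius≥ d (suc m)) (+-mono-≤ (ballCount-suc-radius≥ d m) (ballCount-step d m)) ⟩
    suc (suc m) * B (suc (suc m)) + (suc m * B (suc m) + B (suc m))
      ≡⟨ collect m (B (suc (suc m))) (B (suc m)) ⟩
    suc (suc m) * (B (suc (suc m)) + B (suc m))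
      ∎
    where
    open ≤-Reasoning
    B  = ballCount d
    B′ = ballCount (suc d)
    split : ∀ d x y z → suc d * (x + y + z) ≡ suc d * x + suc d * (y + z)
    split = solve-∀
    regroup : ∀ m d y z → suc m * (y + z) + suc d * (y + z) ≡ suc (suc m + d) * y + (suc (m + d) * z + z)
    regroup = solve-∀
    collect : ∀ m y z → suc (suc m) * y + (suc m * z + z) ≡ suc (suc m) * (y + z)
    collect = solve-∀

ballCount-suc-dim≤ : ∀ d m → d * ballCount (suc d) m ≤ 2 * (m + d) * ballCount d m
ballCount-suc-dim≤ d zero = begin
  d * ballCount (suc d) 0    ≡⟨ cong (d *_) (trans (ballCount-zero (suc d)) (sym (ballCount-zero d))) ⟩
  d * ballCount d 0          ≤⟨ *-monoˡ-≤ (ballCount d 0) (m≤m+n d (d + 0)) ⟩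
  2 * (0 + d) * ballCount d 0 ∎
  where open ≤-Reasoning
ballCount-suc-dim≤ d (suc m) = begin
  d * B′ (suc m)
    ≡⟨ cong (d *_) (addCoordinate-suc B m) ⟩
  d * (B′ m + B (suc m) + B m)
    ≡⟨ split d (B′ m) (B (suc m)) (B m) ⟩
  d * B′ m + d * B (suc m) + d * B m
    ≤⟨ +-monoˡ-≤ _ (+-monoˡ-≤ _ (ballCount-suc-dim≤ d m)) ⟩
  2 * (m + d) * B m + d * B (suc m) + d * B m
    ≡⟨ regroup m d (B (suc m)) (B m) ⟩
  (2 * m + 3 * d) * B m + d * B (suc m)
    ≤⟨ +-monoˡ-≤ _ (weaken (ballCount-suc-radius≥ d m)) ⟩
  (2 * m + d + 2) * B (suc m) + d * B (suc m)
    ≡⟨ collect m d (B (suc m)) ⟩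
  2 * (suc m + d) * B (suc m)
    ∎
  where
  open ≤-Reasoning
  B  = ballCount d
  B′ = ballCount (suc d)
  -- (2m + 3d)(m + 1) ≤ (2m + d + 2)(m + d + 1), the difference being 2m + d² + 2.
  weaken : ∀ {y z} → suc (m + d) * y ≤ suc m * z → (2 * m + 3 * d) * y ≤ (2 * m + d + 2) * z
  weaken {y} {z} growth = *-cancelˡ-≤ (suc m) (begin
    suc m * ((2 * m + 3 * d) * y)
      ≡⟨ *-assoc (suc m) (2 * m + 3 * d) y ⟨
    (suc m * (2 * m + 3 * d)) * y
      ≤⟨ *-monoˡ-≤ y (≤-trans (m≤m+n (suc m * (2 * m + 3 * d)) (2 * m + d * d + 2)) (≤-reflexive (expand m d))) ⟩
    ((2 * m + d + 2) * suc (m + d)) * y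
      ≡⟨ *-assoc (2 * m + d + 2) (suc (m + d)) y ⟩
    (2 * m + d + 2) * (suc (m + d) * y)
      ≤⟨ *-monoʳ-≤ (2 * m + d + 2) growth ⟩
    (2 * m + d + 2) * (suc m * z)
      ≡⟨ x[yz]≡y[xz] (2 * m + d + 2) (suc m) z ⟩
    suc m * ((2 * m + d + 2) * z)
      ∎)
    where
    expand : ∀ m d → suc m * (2 * m + 3 * d) + (2 * m + d * d + 2) ≡ (2 * m + d + 2) * suc (m + d)
    expand = solve-∀
    x[yz]≡y[xz] : ∀ x y z → x * (y * z) ≡ y * (x * z)
    x[yz]≡y[xz] = solve-∀
  split : ∀ d x y z → d * (x + y + z) ≡ d * x + d * y + d * z
  split = solve-∀
  regroup : ∀ m d y z → 2 * (m + d) * z + d * y + d * z ≡ (2 * m + 3 * d) * z + d * y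
  regroup = solve-∀
  collect : ∀ m d y → (2 * m + d + 2) * y + d * y ≡ 2 * (suc m + d) * y
  collect = solve-∀

addCoordinate-≥ : ∀ c k m → (∀ j → c m ≤ c (j + m)) → (1 + 2 * k) * c m ≤ addCoordinate c (k + m)
addCoordinate-≥ c zero    m mono = ≤-trans (≤-reflexive (*-identityˡ (c m))) (m≤m+n (c m) _)
addCoordinate-≥ c (suc k) m mono = begin
  (1 + 2 * suc k) * c m
    ≡⟨ expand k (c m) ⟩
  (1 + 2 * k) * c m + c m + c m
    ≤⟨ +-mono-≤ (+-mono-≤ (addCoordinate-≥ c k m mono) (mono (suc k))) (mono k) ⟩
  addCoordinate c (k + m) + c (suc k + m) + c (k + m)
    ≡⟨ addCoordinate-suc c (k + m) ⟨
  addCoordinate c (suc k + m)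
    ∎
  where
  open ≤-Reasoning
  expand : ∀ k x → (1 + 2 * suc k) * x ≡ (1 + 2 * k) * x + x + x
  expand = solve-∀

cube≤ballCount : ∀ d k m → d * k ≤ m → (1 + 2 * k) ^ d ≤ ballCount d m
cube≤ballCount zero    k m _    = ≤-refl
cube≤ballCount (suc d) k m k+dk≤m = begin
  (1 + 2 * k) * (1 + 2 * k) ^ d
    ≤⟨ *-monoʳ-≤ (1 + 2 * k) (cube≤ballCount d k (m ∸ k) dk≤m∸k) ⟩
  (1 + 2 * k) * ballCount d (m ∸ k)
    ≤⟨ addCoordinate-≥ (ballCount d) k (m ∸ k) (λ j → ballCount-mono d j (m ∸ k)) ⟩
  ballCount (suc d) (k + (m ∸ k))
    ≡⟨ cong (ballCount (suc d)) (m+[n∸m]≡n (≤-trans (m≤m+n k (d * k)) k+dk≤m)) ⟩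
  ballCount (suc d) m
    ∎
  where
  open ≤-Reasoning
  dk≤m∸k : d * k ≤ m ∸ k
  dk≤m∸k = m+n≤o⇒m≤o∸n (d * k) (≤-trans (≤-reflexive (+-comm (d * k) k)) k+dk≤m)

^-distrib-* : ∀ x y n → (x * y) ^ n ≡ x ^ n * y ^ n
^-distrib-* x y zero    = refl
^-distrib-* x y (suc n) = trans (cong ((x * y) *_) (^-distrib-* x y n)) (interchange x y (x ^ n) (y ^ n))
  where
  interchange : ∀ x y u v → (x * y) * (u * v) ≡ (x * u) * (y * v)
  interchange = solve-∀

radius^D≤ballCount : ∀ d r → (suc d + r) ^ suc d ≤ (2 * suc d) ^ suc d * ballCount (suc d) r
radius^D≤ballCount d r = begin
  (D + r) ^ D                        ≤⟨ ^-monoˡ-≤ D D+r≤2D[1+2k] ⟩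
  (2 * D * (1 + 2 * k)) ^ D          ≡⟨ ^-distrib-* (2 * D) (1 + 2 * k) D ⟩
  (2 * D) ^ D * (1 + 2 * k) ^ D      ≤⟨ *-monoʳ-≤ ((2 * D) ^ D) (cube≤ballCount D k r Dk≤r) ⟩
  (2 * D) ^ D * ballCount D r        ∎
  where
  open ≤-Reasoning
  D = suc d
  k = r / D
  Dk≤r : D * k ≤ r
  Dk≤r = ≤-trans (≤-reflexive (*-comm D k)) (m/n*n≤m r D)
  D+r≤2D[1+2k] : D + r ≤ 2 * D * (1 + 2 * k)
  D+r≤2D[1+2k] = begin
    D + r                          ≡⟨ cong (D +_) (m≡m%n+[m/n]*n r D) ⟩
    D + (r % D + k * D)            ≤⟨ +-monoʳ-≤ D (+-monoˡ-≤ (k * D) (<⇒≤ (m%n<n r D))) ⟩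
    D + (D + k * D)                ≤⟨ m≤m+n _ (3 * (k * D)) ⟩
    D + (D + k * D) + 3 * (k * D)  ≡⟨ expand D k ⟩
    2 * D * (1 + 2 * k)            ∎
    where
    expand : ∀ D k → D + (D + k * D) + 3 * (k * D) ≡ 2 * D * (1 + 2 * k)
    expand = solve-∀

ballCount≤radius*sphereCount : ∀ d r → 1 ≤ d →
  suc d * ballCount (suc d) r ≤ 4 * (suc d + r) * sphereCount (suc d) r
ballCount≤radius*sphereCount d r 1≤d = begin
  suc d * ballCount (suc d) r          ≤⟨ *-monoˡ-≤ (ballCount (suc d) r) (+-mono-≤ 1≤d (m≤m+n d 0)) ⟩
  2 * d * ballCount (suc d) r          ≡⟨ *-assoc 2 d _ ⟩
  2 * (d * ballCount (suc d) r)        ≤⟨ *-monoʳ-≤ 2 (ballCount-suc-dim≤ d r) ⟩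
  2 * (2 * (r + d) * ballCount d r)    ≤⟨ *-monoʳ-≤ 2 (*-monoʳ-≤ (2 * (r + d)) (ballCount≤sphereCount-suc d r)) ⟩
  2 * (2 * (r + d) * S)                ≡⟨ regroup r d S ⟩
  4 * (r + d) * S                      ≤⟨ *-monoˡ-≤ S (*-monoʳ-≤ 4 (≤-trans (≤-reflexive (+-comm r d)) (n≤1+n (d + r)))) ⟩
  4 * (suc d + r) * S                  ∎
  where
  open ≤-Reasoning
  S = sphereCount (suc d) r
  regroup : ∀ r d S → 2 * (2 * (r + d) * S) ≡ 4 * (r + d) * S
  regroup = solve-∀

ballCount^[D-1]≤[8⋅sphereCount]^D : ∀ d r → 1 ≤ d →
  ballCount (suc d) r ^ d ≤ 8 ^ suc d * sphereCount (suc d) r ^ suc d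
ballCount^[D-1]≤[8⋅sphereCount]^D d r 1≤d = *-cancelˡ-≤ P {{>-nonZero (m^n>0 (D + r) D)}} (begin
  P * B ^ d                 ≤⟨ *-monoˡ-≤ (B ^ d) (radius^D≤ballCount d r) ⟩
  ((2 * D) ^ D * B) * B ^ d ≡⟨ *-assoc ((2 * D) ^ D) B (B ^ d) ⟩
  (2 * D) ^ D * B ^ D       ≡⟨ ^-distrib-* (2 * D) B D ⟨
  (2 * D * B) ^ D           ≤⟨ ^-monoˡ-≤ D 2DB≤[D+r]8S ⟩
  ((D + r) * (8 * S)) ^ D   ≡⟨ ^-distrib-* (D + r) (8 * S) D ⟩
  P * (8 * S) ^ D           ≡⟨ cong (P *_) (^-distrib-* 8 S D) ⟩
  P * (8 ^ D * S ^ D)       ∎)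
  where
  open ≤-Reasoning
  D = suc d
  B = ballCount D r
  S = sphereCount D r
  P = (D + r) ^ D
  2DB≤[D+r]8S : 2 * D * B ≤ (D + r) * (8 * S)
  2DB≤[D+r]8S = begin
    2 * D * B               ≡⟨ *-assoc 2 D B ⟩
    2 * (D * B)             ≤⟨ *-monoʳ-≤ 2 (ballCount≤radius*sphereCount d r 1≤d) ⟩
    2 * (4 * (D + r) * S)   ≡⟨ regroup (D + r) S ⟩
    (D + r) * (8 * S)       ∎
    where
    regroup : ∀ x S → 2 * (4 * x * S) ≡ x * (8 * S)
    regroup = solve-∀

proposition2p14 : Σ[ p ∈ ℕ ] Σ[ q ∈ ℕ ] (0 < p × 0 < q × (Σ[ d₀ ∈ ℕ ] ((d : ℕ) → 1 ≤ d → d₀ ≤ d → (r : ℕ) →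
    p ^ d * b d r ^ (d ∸ 1) ≤ q ^ d * s d r ^ d)))
proposition2p14 = 1 , 8 , z<s , z<s , 2 , bound
  where
  bound : (d : ℕ) → 1 ≤ d → 2 ≤ d → (r : ℕ) → 1 ^ d * b d r ^ (d ∸ 1) ≤ 8 ^ d * s d r ^ d
  bound (suc zero)    _ (s≤s ()) r
  bound (suc (suc d)) _ _        r = begin
    1 ^ D * b D r ^ suc d          ≡⟨ cong (_* b D r ^ suc d) (^-zeroˡ D) ⟩
    1 * b D r ^ suc d              ≡⟨ *-identityˡ _ ⟩
    b D r ^ suc d                  ≡⟨ cong (_^ suc d) (b≡ballCount D r) ⟩
    ballCount D r ^ suc d          ≤⟨ ballCount^[D-1]≤[8⋅sphereCount]^D (suc d) r z<s ⟩
    8 ^ D * sphereCount D r ^ D    ≡⟨ cong (λ t → 8 ^ D * t ^ D) (s≡sphereCount D r) ⟨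
    8 ^ D * s D r ^ D              ∎
    where
    open ≤-Reasoning
    D = suc (suc d)
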